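{- Let $K$ be the class of all algebras $(A,;,\cdot)$ such that, for some set $U$, $A$ is a set of binary relations on $U$ that is closed under composition and intersection, where for $a,b\in A$, $a;b=\{(x,y): \text{for some } z\in U,\ (x,z)\in a \text{ and } (z,y)\in b\}$ and $a\cdot b=a\cap b$. Then $K$ does not have the finite representation property: there exists a finite algebra in $K$ that is not isomorphic to any algebra in $K$ whose base set $U$ is finite.
   Context: A class $K$ of algebras, equipped with a notion of "representable over a set $U$", has the finite representation property if every finite algebra in $K$ that is representable over some set is representable over a finite set. For the class $K$ here, an algebra is representable over $U$ if it is isomorphic to an algebra of binary relations on $U$ closed under composition and intersection, with the operations interpreted as composition and intersection. -}

module Defs where

open import Data.Nat using (ℕ)
open import Data.Fin using (Fin)
open import Data.Product using (Σ; ∃; _×_)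
open import Relation.Binary.PropositionalEquality using (_≡_)
open import Function.Bundles using (_⇔_)

record FinAlg : Set where
  field
    size : ℕ
    _⨾_  : Fin size → Fin size → Fin size
    _·_  : Fin size → Fin size → Fin size

BinRel : Set → Set₁
BinRel U = U → U → Set

_∘ᴿ_ : {U : Set} → BinRel U → BinRel U → BinRel U
(r ∘ᴿ s) x y = ∃ λ z → r x z × s z y

_∩ᴿ_ : {U : Set} → BinRel U → BinRel U → BinRel U
(r ∩ᴿ s) x y = r x y × s x y

_≐_ : {U : Set} → BinRel U → BinRel U → Set
r ≐ s = ∀ x y → r x y ⇔ s x y

-- Its image is a set of relations on U closed under composition and
-- intersection, and h is an isomorphism of A onto that algebra of relations.
record RepresentationOver (A : FinAlg) (U : Set) : Set₁ where
  open FinAlg A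
  field
    h    : Fin size → BinRel U
    inj  : ∀ a b → h a ≐ h b → a ≡ b
    comp : ∀ a b → h (a ⨾ b) ≐ (h a ∘ᴿ h b)
    meet : ∀ a b → h (a · b) ≐ (h a ∩ᴿ h b)

Representable : FinAlg → Set₁
Representable A = Σ Set λ U → RepresentationOver A U

FinitelyRepresentable : FinAlg → Set₁
FinitelyRepresentable A = Σ ℕ λ m → RepresentationOver A (Fin m)

-- The empty relation, the identity and a dense strict order < form an algebra
-- closed under ; and ·, e.g. over ℚ.  In any representation the image S of <
-- is transitive and dense, and its meet with the image of the identity is the
-- image Z of ∅, which absorbs composition with S.  Over a finite set, repeated
-- interpolation between x and y must revisit a point w, giving w S w; from
-- this w Z w, hence x Z y.  So S = Z, contradicting injectivity.
module Submission where

open import Defs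
open import Data.Nat as ℕ using (ℕ; zero; suc; z<s)
open import Data.Nat.Properties using (n<1+n; m<1+n⇒m<n∨m≡n)
open import Data.Fin as Fin using (Fin; zero; suc; toℕ)
open import Data.Fin.Properties using (pigeonhole)
open import Data.Product using (Σ; ∃; ∃₂; _×_; _,_; proj₁; proj₂)
open import Data.Sum using (inj₁; inj₂)
open import Data.Empty using (⊥)
open import Data.Unit using (tt)
open import Relation.Nullary using (¬_)
open import Relation.Nullary.Decidable using (toWitness)
open import Relation.Binary.Definitions using (Irreflexive; Transitive; Dense)
open import Relation.Binary.PropositionalEquality using (_≡_; refl; subst)
open import Function.Bundles using (mk⇔; Equivalence)
open import Data.Rational using (ℚ; 0ℚ; 1ℚ)
import Data.Rational.Properties as ℚ

pattern 𝟘 = zero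
pattern 𝟙 = suc zero
pattern ≺ = suc (suc zero)

_⨾₃_ : Fin 3 → Fin 3 → Fin 3
𝟘 ⨾₃ _ = 𝟘
𝟙 ⨾₃ b = b
≺ ⨾₃ 𝟘 = 𝟘
≺ ⨾₃ 𝟙 = ≺
≺ ⨾₃ ≺ = ≺

_·₃_ : Fin 3 → Fin 3 → Fin 3
𝟙 ·₃ 𝟙 = 𝟙
≺ ·₃ ≺ = ≺
_ ·₃ _ = 𝟘

order-algebra : FinAlg
order-algebra = record { size = 3 ; _⨾_ = _⨾₃_ ; _·_ = _·₃_ }

module _ {U : Set} {_<ᵁ_ : BinRel U}
         (<-irrefl : Irreflexive _≡_ _<ᵁ_) (<-trans : Transitive _<ᵁ_)
         (<-dense : Dense _<ᵁ_) {x₀ y₀ : U} (x₀<y₀ : x₀ <ᵁ y₀) where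

  ⟦_⟧ : Fin 3 → BinRel U
  ⟦ 𝟘 ⟧ _ _ = ⊥
  ⟦ 𝟙 ⟧ x y = x ≡ y
  ⟦ ≺ ⟧ x y = x <ᵁ y

  ⟦⟧-comp : ∀ a b → ⟦ a ⨾₃ b ⟧ ≐ (⟦ a ⟧ ∘ᴿ ⟦ b ⟧)
  ⟦⟧-comp 𝟘 b x y = mk⇔ (λ ()) (λ { (_ , () , _) })
  ⟦⟧-comp 𝟙 b x y = mk⇔ (λ p → x , refl , p) (λ { (_ , refl , p) → p })
  ⟦⟧-comp ≺ 𝟘 x y = mk⇔ (λ ()) (λ { (_ , _ , ()) })
  ⟦⟧-comp ≺ 𝟙 x y = mk⇔ (λ p → y , p , refl) (λ { (_ , p , refl) → p })
  ⟦⟧-comp ≺ ≺ x y = mk⇔ <-dense (λ { (_ , p , q) → <-trans p q })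

  ⟦⟧-meet : ∀ a b → ⟦ a ·₃ b ⟧ ≐ (⟦ a ⟧ ∩ᴿ ⟦ b ⟧)
  ⟦⟧-meet 𝟘 b x y = mk⇔ (λ ()) (λ { (() , _) })
  ⟦⟧-meet 𝟙 𝟘 x y = mk⇔ (λ ()) (λ { (_ , ()) })
  ⟦⟧-meet 𝟙 𝟙 x y = mk⇔ (λ p → p , p) proj₁
  ⟦⟧-meet 𝟙 ≺ x y = mk⇔ (λ ()) (λ { (refl , p) → <-irrefl refl p })
  ⟦⟧-meet ≺ 𝟘 x y = mk⇔ (λ ()) (λ { (_ , ()) })
  ⟦⟧-meet ≺ 𝟙 x y = mk⇔ (λ ()) (λ { (p , refl) → <-irrefl refl p })
  ⟦⟧-meet ≺ ≺ x y = mk⇔ (λ p → p , p) proj₁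

  ⟦⟧-injective : ∀ a b → ⟦ a ⟧ ≐ ⟦ b ⟧ → a ≡ b
  ⟦⟧-injective 𝟘 𝟘 _ = refl
  ⟦⟧-injective 𝟘 𝟙 e with () ← Equivalence.from (e x₀ x₀) refl
  ⟦⟧-injective 𝟘 ≺ e with () ← Equivalence.from (e x₀ y₀) x₀<y₀
  ⟦⟧-injective 𝟙 𝟘 e with () ← Equivalence.to (e x₀ x₀) refl
  ⟦⟧-injective 𝟙 𝟙 _ = refl
  ⟦⟧-injective 𝟙 ≺ e with () ← <-irrefl refl (Equivalence.to (e x₀ x₀) refl)
  ⟦⟧-injective ≺ 𝟘 e with () ← Equivalence.to (e x₀ y₀) x₀<y₀
  ⟦⟧-injective ≺ 𝟙 e with () ← <-irrefl refl (Equivalence.from (e x₀ x₀) refl)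
  ⟦⟧-injective ≺ ≺ _ = refl

  dense-order-representation : RepresentationOver order-algebra U
  dense-order-representation = record
    { h = ⟦_⟧ ; inj = ⟦⟧-injective ; comp = ⟦⟧-comp ; meet = ⟦⟧-meet }

ℚ-representation : RepresentationOver order-algebra ℚ
ℚ-representation =
  dense-order-representation ℚ.<-irrefl ℚ.<-trans ℚ.<-dense (toWitness {a? = 0ℚ ℚ.<? 1ℚ} tt)

chain-related : {A : Set} (_R_ : BinRel A) → Transitive _R_ →
                (f : ℕ → A) → (∀ k → f k R f (suc k)) →
                ∀ {i j} → i ℕ.< j → f i R f j
chain-related _R_ trans f step {i} {suc j} i<1+j with m<1+n⇒m<n∨m≡n i<1+j
... | inj₁ i<j  = trans (chain-related _R_ trans f step i<j) (step j)
... | inj₂ refl = step i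

module _ {m : ℕ} {_R_ : BinRel (Fin m)} (R-trans : Transitive _R_) (R-dense : Dense _R_) where

  finite-dense-loop : ∀ {x y} → x R y → ∃ λ w → x R w × w R w × w R y
  finite-dense-loop {x} {y} xRy = loop-at (pigeonhole (n<1+n m) (λ k → point (toℕ k)))
    where
    approach : ℕ → Σ (Fin m) (_R y)
    approach zero    = x , xRy
    approach (suc k) with z , _ , zRy ← R-dense (proj₂ (approach k)) = z , zRy

    point : ℕ → Fin m
    point k = proj₁ (approach k)

    step : ∀ k → point k R point (suc k)
    step k with _ , pRz , _ ← R-dense (proj₂ (approach k)) = pRz

    chain : ∀ {i j} → i ℕ.< j → point i R point j
    chain = chain-related _R_ R-trans point step

    loop-at : (∃₂ λ i j → i Fin.< j × point (toℕ i) ≡ point (toℕ j)) →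
              ∃ λ w → x R w × w R w × w R y
    loop-at (i , j , i<j , pᵢ≡pⱼ) =
      point (toℕ j) , chain (0<j i<j) ,
      subst (_R point (toℕ j)) pᵢ≡pⱼ (chain i<j) , proj₂ (approach (toℕ j))
      where
      0<j : ∀ {i j : ℕ} → i ℕ.< j → 0 ℕ.< j
      0<j {j = suc _} _ = z<s

module _ {U : Set} (ρ : RepresentationOver order-algebra U) where
  open RepresentationOver ρ

  private
    comp-intro : ∀ a b {x z y} → h a x z → h b z y → h (a ⨾₃ b) x y
    comp-intro a b {x} {z} {y} p q = Equivalence.from (comp a b x y) (z , p , q)

    meet-intro : ∀ a b {x y} → h a x y → h b x y → h (a ·₃ b) x y
    meet-intro a b {x} {y} p q = Equivalence.from (meet a b x y) (p , q)

  ≺-trans : Transitive (h ≺)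
  ≺-trans = comp-intro ≺ ≺

  ≺-dense : Dense (h ≺)
  ≺-dense {x} {y} = Equivalence.to (comp ≺ ≺ x y)

  ≺-loop⇒𝟘 : ∀ {w} → h ≺ w w → h 𝟘 w w
  ≺-loop⇒𝟘 {w} wSw with z , wIz , zSw ← Equivalence.to (comp 𝟙 ≺ w w) wSw =
    comp-intro 𝟘 ≺ (meet-intro 𝟙 ≺ wIz (comp-intro ≺ 𝟙 wSw wIz)) zSw

  loops-unrepresentable : (∀ {x y} → h ≺ x y → ∃ λ w → h ≺ x w × h ≺ w w × h ≺ w y) → ⊥
  loops-unrepresentable loop = ≺≢𝟘 (inj ≺ 𝟘 (λ x y → mk⇔ (≺⊆𝟘 x y) (𝟘⊆≺ x y)))
    where
    ≺⊆𝟘 : ∀ x y → h ≺ x y → h 𝟘 x y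
    ≺⊆𝟘 x y xSy with w , xSw , wSw , wSy ← loop xSy =
      comp-intro ≺ 𝟘 xSw (comp-intro 𝟘 ≺ (≺-loop⇒𝟘 wSw) wSy)

    𝟘⊆≺ : ∀ x y → h 𝟘 x y → h ≺ x y
    𝟘⊆≺ x y p = proj₂ (Equivalence.to (meet 𝟘 ≺ x y) p)

    ≺≢𝟘 : ¬ (_≡_ {A = Fin 3} ≺ 𝟘)
    ≺≢𝟘 ()

theorem1 : Σ FinAlg λ A → Representable A × ¬ FinitelyRepresentable A
theorem1 = order-algebra , (ℚ , ℚ-representation) , λ where
  (m , ρ) → loops-unrepresentable ρ (finite-dense-loop (≺-trans ρ) (≺-dense ρ))
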